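{- For any polytope $\mathcal{P}$ containing the origin as a vertex, $S^0_{\mathcal{P}}(x)\le x\,S^1_{\mathcal{P}}(x)$ coefficient-wise.
   Context: $S^0_{\mathcal{P}}(x)=\sum_F x^{\dim F+1}$ summed over simplex faces $F$ of $\mathcal{P}$ containing the origin; $S^1_{\mathcal{P}}(x)=\sum_F x^{\dim F+1}$ summed over simplex faces of $\mathcal{P}$ not containing the origin, where the empty face counts as a simplex of dimension $-1$. Polynomial inequalities are coefficient-wise. -}

module Defs where

open import Level using (0ℓ)
open import Data.Nat as ℕ using (ℕ; zero; suc)
open import Data.Fin using (Fin; zero; suc)
open import Data.Fin.Subset using (Subset; _∈_; _∉_; ∣_∣; ⁅_⁆)
open import Data.List using (List; length)
open import Data.List.Relation.Unary.All using (All)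
open import Data.List.Relation.Unary.Unique.Propositional using (Unique)
open import Data.Product using (Σ; ∃; _×_; _,_)
open import Function.Bundles using (_⇔_)
open import Relation.Nullary using (¬_)
open import Relation.Binary using (Rel; IsTotalOrder)
open import Relation.Binary.PropositionalEquality using (_≡_; _≢_)
open import Algebra.Core using (Op₁; Op₂)
open import Algebra.Structures using (IsCommutativeRing)

-- Ordered fields (ℝ is the intended instance).  Polytopes and their
-- face structure are stated over an arbitrary ordered field.

record OrderedField : Set₁ where
  infixl 6 _+_
  infixl 7 _*_
  infix  4 _≤_
  field
    Carrier           : Set
    _+_ _*_           : Op₂ Carrier
    -_                : Op₁ Carrier
    0# 1#             : Carrier
    isCommutativeRing : IsCommutativeRing _≡_ _+_ _*_ -_ 0# 1#
    0≢1               : 0# ≢ 1#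
    inv               : (x : Carrier) → x ≢ 0# → Carrier
    inv-cancel        : ∀ x (p : x ≢ 0#) → x * inv x p ≡ 1#
    _≤_               : Rel Carrier 0ℓ
    isTotalOrder      : IsTotalOrder _≡_ _≤_
    +-mono-≤          : ∀ {x y} z → x ≤ y → x + z ≤ y + z
    *-nonneg          : ∀ {x y} → 0# ≤ x → 0# ≤ y → 0# ≤ x * y

-- Finite cardinality comparison for (possibly undecidable) predicates on
-- a finite type: #{x | P x} ≤ #{x | Q x}, phrased as: every duplicate-free
-- list of P-elements is matched by a duplicate-free list of Q-elements
-- that is at least as long.

CardLe : {A : Set} → (A → Set) → (A → Set) → Set
CardLe {A} P Q =
  (L : List A) → Unique L → All P L →
  Σ (List A) λ L′ → Unique L′ × All Q L′ × (length L ℕ.≤ length L′)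

module Polytopes (𝔽 : OrderedField) where
  open OrderedField 𝔽

  Σ[_] : ∀ {k} → (Fin k → Carrier) → Carrier
  Σ[_] {zero}  f = 0#
  Σ[_] {suc k} f = f zero + Σ[ (λ i → f (suc i)) ]

  Point : ℕ → Set
  Point n = Fin n → Carrier

  origin : ∀ {n} → Point n
  origin _ = 0#

  _·_ : ∀ {n} → Point n → Point n → Carrier
  c · v = Σ[ (λ j → c j * v j) ]

  -- A face of conv{V i} described by the set S of vertex indices it
  -- contains: there is a valid inequality c·x ≤ b for the polytope whose
  -- equality set among the vertices is exactly S.  (c = 0, b = 1 gives
  -- the empty face; c = 0, b = 0 the whole polytope.)
  IsFace : ∀ {n m} → (Fin m → Point n) → Subset m → Set
  IsFace {n} V S = Σ (Point n) λ c → Σ Carrier λ b →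
    (∀ i → c · V i ≤ b) × (∀ i → (c · V i ≡ b) ⇔ (i ∈ S))

  AffinelyIndependent : ∀ {n m} → (Fin m → Point n) → Subset m → Set
  AffinelyIndependent {n} {m} V S =
    (w : Fin m → Carrier) →
    (∀ i → i ∉ S → w i ≡ 0#) →
    Σ[ w ] ≡ 0# →
    (∀ j → Σ[ (λ i → w i * V i j) ] ≡ 0#) →
    ∀ i → w i ≡ 0#

  -- A simplex face: a face whose vertices are affinely independent;
  -- its dimension is ∣ S ∣ - 1 (the empty face has dimension -1).
  IsSimplexFace : ∀ {n m} → (Fin m → Point n) → Subset m → Set
  IsSimplexFace V S = IsFace V S × AffinelyIndependent V S

  ContainsOrigin : ∀ {n m} → (Fin m → Point n) → Subset m → Set
  ContainsOrigin V S = ∃ λ i → i ∈ S × V i ≡ origin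

  IsVertexList : ∀ {n m} → (Fin m → Point n) → Set
  IsVertexList V = (∀ i j → V i ≡ V j → i ≡ j) × (∀ i → IsFace V ⁅ i ⁆)

  -- coefficient of x^k in S⁰_P(x): simplex faces F ∋ 0 with dim F + 1 = k
  S⁰-term : ∀ {n m} → (Fin m → Point n) → ℕ → Subset m → Set
  S⁰-term V k S = IsSimplexFace V S × ContainsOrigin V S × ∣ S ∣ ≡ k

  -- coefficient of x^k in x·S¹_P(x): simplex faces F ∌ 0 with dim F + 2 = k
  xS¹-term : ∀ {n m} → (Fin m → Point n) → ℕ → Subset m → Set
  xS¹-term V k S = IsSimplexFace V S × ¬ ContainsOrigin V S × suc ∣ S ∣ ≡ k

{-# OPTIONS --safe #-}
-- Deleting the origin from a simplex face F ∋ 0 leaves a simplex face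
-- F′ ∌ 0 with one vertex fewer, and F ↦ F′ is injective on faces containing the origin, so it
-- injects the faces counted by the coefficient of xᵏ in S⁰ into those counted by that of x·S¹.
-- F′ is a face: F is cut out by some c · x ≤ 0 (the level is 0 because 0 ∈ F), the remaining
-- vertices of F are linearly independent, so some d has d · v = 1 on them, and for Λ large the
-- inequality (Λ c + d) · x ≤ 1 cuts out exactly F′.
module Submission where

open import Defs
open import Level using (0ℓ)
open import Algebra.Bundles using (CommutativeRing)
import Algebra.Properties.CommutativeSemigroup as CommutativeSemigroupProperties
import Algebra.Properties.Ring as RingProperties
import Algebra.Properties.Semiring.Sum as SemiringSum
open import Data.Empty using (⊥-elim)
open import Data.Fin using (Fin; zero; suc; _≟_)
open import Data.Fin.Properties using (sequence)
open import Data.Fin.Subset using (Subset; _∈_; _∉_; _⊆_; inside; outside; _-_; ⁅_⁆; ∣_∣)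
open import Data.Fin.Subset.Properties using (_∈?_; p─q⊆p; p─⊥≡p; x∈p∧x≢y⇒x∈p-y; ⊆-antisym)
open import Data.List using (map)
open import Data.List.Properties using (length-map)
open import Data.List.Relation.Unary.All as All using (All; []; _∷_)
import Data.List.Relation.Unary.All.Properties as All
open import Data.List.Relation.Unary.AllPairs using ([]; _∷_)
open import Data.List.Relation.Unary.Unique.Propositional using (Unique)
open import Data.Nat using (ℕ; zero; suc)
import Data.Nat.Properties as ℕₚ
open import Data.Product using (∃; _×_; _,_; proj₁; proj₂)
open import Data.Sum using (_⊎_; inj₁; inj₂)
import Data.Vec.Functional as Vector
open import Data.Vec.Base using (_∷_; []; here; there)
open import Effect.Monad using (RawMonad)
open import Function using (_∘_; _⇔_; mk⇔; Equivalence)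
open import Relation.Binary using (IsTotalOrder; Poset)
open import Relation.Binary.PropositionalEquality
import Relation.Binary.Reasoning.PartialOrder as PosetReasoning
open import Relation.Nullary using (¬_; Dec; yes; no)
open import Relation.Nullary.Negation using (¬¬-Monad)

x∉p-x : ∀ {n} (x : Fin n) (p : Subset n) → x ∉ p - x
x∉p-x zero    (_ ∷ p) ()
x∉p-x (suc x) (_ ∷ p) (there x∈p-x) = x∉p-x x p x∈p-x

x∈p⇒x≡y⊎x∈p-y : ∀ {n} {x y : Fin n} {p} → x ∈ p → x ≡ y ⊎ x ∈ p - y
x∈p⇒x≡y⊎x∈p-y {x = x} {y} x∈p with x ≟ y
... | yes x≡y = inj₁ x≡y
... | no  x≢y = inj₂ (x∈p∧x≢y⇒x∈p-y x∈p x≢y)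

x∈p⇒∣p-x∣+1≡∣p∣ : ∀ {n} {x : Fin n} {p} → x ∈ p → suc ∣ p - x ∣ ≡ ∣ p ∣
x∈p⇒∣p-x∣+1≡∣p∣ {x = zero}  {inside  ∷ p} here = cong (suc ∘ ∣_∣) (p─⊥≡p p)
x∈p⇒∣p-x∣+1≡∣p∣ {x = suc x} {inside  ∷ p} (there x∈p) = cong suc (x∈p⇒∣p-x∣+1≡∣p∣ x∈p)
x∈p⇒∣p-x∣+1≡∣p∣ {x = suc x} {outside ∷ p} (there x∈p) = x∈p⇒∣p-x∣+1≡∣p∣ x∈p

p-x≡q-x⇒p≡q : ∀ {n} {x : Fin n} {p q} → x ∈ p → x ∈ q → p - x ≡ q - x → p ≡ q
p-x≡q-x⇒p≡q {x = x} x∈p x∈q p-x≡q-x = ⊆-antisym (⊆-via p-x≡q-x x∈q) (⊆-via (sym p-x≡q-x) x∈p)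
  where
  ⊆-via : ∀ {r s} → r - x ≡ s - x → x ∈ s → r ⊆ s
  ⊆-via {s = s} r-x≡s-x x∈s i∈r with x∈p⇒x≡y⊎x∈p-y {y = x} i∈r
  ... | inj₁ refl    = x∈s
  ... | inj₂ i∈r-x   = p─q⊆p s ⁅ x ⁆ (subst (_ ∈_) r-x≡s-x i∈r-x)

module _ {A : Set} {P Q : A → Set} (f : A → A) (P⇒Q∘f : ∀ {a} → P a → Q (f a))
         (injectiveOnP : ∀ {a b} → P a → P b → f a ≡ f b → a ≡ b) where

  unique-map⁺ : ∀ {L} → All P L → Unique L → Unique (map f L)
  unique-map⁺ []         []         = []
  unique-map⁺ (Pa ∷ PL) (a∉L ∷ uL) =
    All.map⁺ (All.zipWith (λ (a≢b , Pb) fa≡fb → a≢b (injectiveOnP Pa Pb fa≡fb)) (a∉L , PL))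
    ∷ unique-map⁺ PL uL

  cardLe-injection : CardLe P Q
  cardLe-injection L uL PL =
    map f L , unique-map⁺ PL uL , All.map⁺ (All.map P⇒Q∘f PL) , ℕₚ.≤-reflexive (sym (length-map f L))

module OrderedFieldProperties (𝔽 : OrderedField) where
  open OrderedField 𝔽 public

  commutativeRing : CommutativeRing 0ℓ 0ℓ
  commutativeRing = record { isCommutativeRing = isCommutativeRing }

  open CommutativeRing commutativeRing public
    using (+-comm; +-identityˡ; +-identityʳ; -‿inverseʳ; *-comm; *-assoc; *-identityˡ; *-identityʳ;
           distribˡ; distribʳ; zeroˡ; zeroʳ; ring; *-commutativeSemigroup)
  open RingProperties ring public
    using (-‿distribˡ-*; -‿distribʳ-*; -‿involutive; -0#≈0#; +-cancelˡ;
           x∙y⁻¹≈ε⇒x≈y; //-rightDividesˡ; xyx⁻¹≈y; x[y-z]≈xy-xz)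
  open CommutativeSemigroupProperties *-commutativeSemigroup public using (interchange; xy∙z≈xz∙y)
  open IsTotalOrder isTotalOrder public
    using (total; antisym) renaming (refl to ≤-refl; trans to ≤-trans; reflexive to ≤-reflexive)

  ≤-poset : Poset 0ℓ 0ℓ 0ℓ
  ≤-poset = record { isPartialOrder = IsTotalOrder.isPartialOrder isTotalOrder }

  module ≤-Reasoning = PosetReasoning ≤-poset

  +-monoˡ-≤ : ∀ z {x y} → x ≤ y → z + x ≤ z + y
  +-monoˡ-≤ z {x} {y} x≤y = subst₂ _≤_ (+-comm x z) (+-comm y z) (+-mono-≤ z x≤y)

  x≤y⇒0≤y-x : ∀ {x y} → x ≤ y → 0# ≤ y + - x
  x≤y⇒0≤y-x {x} {y} x≤y = subst (_≤ y + - x) (-‿inverseʳ x) (+-mono-≤ (- x) x≤y)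

  0≤y-x⇒x≤y : ∀ {x y} → 0# ≤ y + - x → x ≤ y
  0≤y-x⇒x≤y {x} {y} 0≤y-x = subst₂ _≤_ (+-identityˡ x) (//-rightDividesˡ x y) (+-mono-≤ x 0≤y-x)

  x≤0⇒0≤-x : ∀ {x} → x ≤ 0# → 0# ≤ - x
  x≤0⇒0≤-x x≤0 = subst (0# ≤_) (+-identityˡ _) (x≤y⇒0≤y-x x≤0)

  x≤x+y : ∀ x {y} → 0# ≤ y → x ≤ x + y
  x≤x+y x {y} 0≤y = subst (_≤ x + y) (+-identityʳ x) (+-monoˡ-≤ x 0≤y)

  *-monoˡ-≤-nonneg : ∀ {z} → 0# ≤ z → ∀ {x y} → x ≤ y → z * x ≤ z * y
  *-monoˡ-≤-nonneg {z} 0≤z {x} {y} x≤y =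
    0≤y-x⇒x≤y (subst (0# ≤_) (x[y-z]≈xy-xz z y x) (*-nonneg 0≤z (x≤y⇒0≤y-x x≤y)))

  -x*-x≡x*x : ∀ x → - x * - x ≡ x * x
  -x*-x≡x*x x = begin
    - x * - x     ≡⟨ -‿distribˡ-* x (- x) ⟨
    - (x * - x)   ≡⟨ cong -_ (-‿distribʳ-* x x) ⟨
    - - (x * x)   ≡⟨ -‿involutive (x * x) ⟩
    x * x         ∎
    where open ≡-Reasoning

  0≤x*x : ∀ x → 0# ≤ x * x
  0≤x*x x with total 0# x
  ... | inj₁ 0≤x = *-nonneg 0≤x 0≤x
  ... | inj₂ x≤0 = subst (0# ≤_) (-x*-x≡x*x x) (*-nonneg (x≤0⇒0≤-x x≤0) (x≤0⇒0≤-x x≤0))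

  0≤1 : 0# ≤ 1#
  0≤1 = subst (0# ≤_) (*-identityʳ 1#) (0≤x*x 1#)

  1≰0 : ¬ 1# ≤ 0#
  1≰0 1≤0 = 0≢1 (antisym 0≤1 1≤0)

  x≤y⇒x≢y+1 : ∀ {x y} → x ≤ y → x ≢ y + 1#
  x≤y⇒x≢y+1 {y = y} y+1≤y refl =
    1≰0 (subst₂ _≤_ (xyx⁻¹≈y y 1#) (-‿inverseʳ y) (+-mono-≤ (- y) y+1≤y))

  0≤inv : ∀ {x} (x≢0 : x ≢ 0#) → 0# ≤ x → 0# ≤ inv x x≢0
  0≤inv {x} x≢0 0≤x with total 0# (inv x x≢0)
  ... | inj₁ 0≤x⁻¹ = 0≤x⁻¹
  ... | inj₂ x⁻¹≤0 =
    ⊥-elim (1≰0 (subst₂ _≤_ (inv-cancel x x≢0) (zeroʳ x) (*-monoˡ-≤-nonneg 0≤x x⁻¹≤0)))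

  x*x≡0⇒¬x≢0 : ∀ {x} → x * x ≡ 0# → ¬ x ≢ 0#
  x*x≡0⇒¬x≢0 {x} x*x≡0 x≢0 = 0≢1 (begin
    0#                        ≡⟨ zeroˡ (x⁻¹ * x⁻¹) ⟨
    0# * (x⁻¹ * x⁻¹)          ≡⟨ cong (_* (x⁻¹ * x⁻¹)) x*x≡0 ⟨
    (x * x) * (x⁻¹ * x⁻¹)     ≡⟨ interchange x x x⁻¹ x⁻¹ ⟩
    (x * x⁻¹) * (x * x⁻¹)     ≡⟨ cong₂ _*_ (inv-cancel x x≢0) (inv-cancel x x≢0) ⟩
    1# * 1#                   ≡⟨ *-identityʳ 1# ⟩
    1#                        ∎)
    where
    open ≡-Reasoning
    x⁻¹ : Carrier
    x⁻¹ = inv x x≢0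

  x*y⁻¹*y≡x : ∀ x {y} (y≢0 : y ≢ 0#) → x * inv y y≢0 * y ≡ x
  x*y⁻¹*y≡x x {y} y≢0 = begin
    x * inv y y≢0 * y     ≡⟨ xy∙z≈xz∙y x (inv y y≢0) y ⟩
    x * y * inv y y≢0     ≡⟨ *-assoc x y (inv y y≢0) ⟩
    x * (y * inv y y≢0)   ≡⟨ cong (x *_) (inv-cancel y y≢0) ⟩
    x * 1#                ≡⟨ *-identityʳ x ⟩
    x                     ∎
    where open ≡-Reasoning

  nonneg-upperBound : ∀ x → ∃ λ A → 0# ≤ A × x ≤ A
  nonneg-upperBound x with total 0# x
  ... | inj₁ 0≤x = x  , 0≤x   , ≤-refl
  ... | inj₂ x≤0 = 0# , ≤-refl , x≤0

module LinearAlgebra (𝔽 : OrderedField) where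
  open OrderedFieldProperties 𝔽
  open Polytopes 𝔽
  open SemiringSum (CommutativeRing.semiring commutativeRing)
    using (sum; sum-cong-≗; sum-replicate-zero; ∑-distrib-+; ∑-comm; *-distribˡ-sum; *-distribʳ-sum)

  Σ≡sum : ∀ {k} (f : Fin k → Carrier) → Σ[ f ] ≡ sum f
  Σ≡sum {zero}  f = refl
  Σ≡sum {suc k} f = cong (f zero +_) (Σ≡sum (f ∘ suc))

  Σ-cong : ∀ {k} {f g : Fin k → Carrier} → f ≗ g → Σ[ f ] ≡ Σ[ g ]
  Σ-cong {f = f} {g} f≗g = trans (Σ≡sum f) (trans (sum-cong-≗ f≗g) (sym (Σ≡sum g)))

  Σ-zero : ∀ {k} {f : Fin k → Carrier} → (∀ i → f i ≡ 0#) → Σ[ f ] ≡ 0#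
  Σ-zero {k} f≗0 = trans (Σ-cong f≗0) (trans (Σ≡sum {k} (λ _ → 0#)) (sum-replicate-zero k))

  Σ-distrib-+ : ∀ {k} (f g : Fin k → Carrier) → Σ[ (λ i → f i + g i) ] ≡ Σ[ f ] + Σ[ g ]
  Σ-distrib-+ f g =
    trans (Σ≡sum (λ i → f i + g i)) (trans (∑-distrib-+ f g) (sym (cong₂ _+_ (Σ≡sum f) (Σ≡sum g))))

  *-distribˡ-Σ : ∀ {k} x (f : Fin k → Carrier) → x * Σ[ f ] ≡ Σ[ (λ i → x * f i) ]
  *-distribˡ-Σ x f = trans (cong (x *_) (Σ≡sum f)) (trans (*-distribˡ-sum x f) (sym (Σ≡sum (λ i → x * f i))))

  *-distribʳ-Σ : ∀ {k} x (f : Fin k → Carrier) → Σ[ f ] * x ≡ Σ[ (λ i → f i * x) ]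
  *-distribʳ-Σ x f = trans (cong (_* x) (Σ≡sum f)) (trans (*-distribʳ-sum x f) (sym (Σ≡sum (λ i → f i * x))))

  Σ-comm : ∀ {k l} (f : Fin k → Fin l → Carrier) →
           Σ[ (λ i → Σ[ f i ]) ] ≡ Σ[ (λ j → Σ[ (λ i → f i j) ]) ]
  Σ-comm f = begin
    Σ[ (λ i → Σ[ f i ]) ]               ≡⟨ trans (Σ-cong (Σ≡sum ∘ f)) (Σ≡sum (λ i → sum (f i))) ⟩
    sum (λ i → sum (f i))               ≡⟨ ∑-comm f ⟩
    sum (λ j → sum (λ i → f i j))       ≡⟨ trans (Σ-cong (λ j → Σ≡sum (λ i → f i j)))
                                                 (Σ≡sum (λ j → sum (λ i → f i j))) ⟨
    Σ[ (λ j → Σ[ (λ i → f i j) ]) ]     ∎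
    where open ≡-Reasoning

  Σ-nonneg : ∀ {k} {f : Fin k → Carrier} → (∀ i → 0# ≤ f i) → 0# ≤ Σ[ f ]
  Σ-nonneg {zero}  0≤f = ≤-refl
  Σ-nonneg {suc k} {f} 0≤f = ≤-trans (0≤f zero) (x≤x+y (f zero) (Σ-nonneg (0≤f ∘ suc)))

  nonneg⇒≤Σ : ∀ {k} {f : Fin k → Carrier} → (∀ i → 0# ≤ f i) → ∀ i → f i ≤ Σ[ f ]
  nonneg⇒≤Σ {suc k} {f} 0≤f zero    = x≤x+y (f zero) (Σ-nonneg (0≤f ∘ suc))
  nonneg⇒≤Σ {suc k} {f} 0≤f (suc i) = ≤-trans (nonneg⇒≤Σ (0≤f ∘ suc) i)
    (subst (_≤ f zero + Σ[ f ∘ suc ]) (+-identityˡ Σ[ f ∘ suc ]) (+-mono-≤ Σ[ f ∘ suc ] (0≤f zero)))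

  nonneg-Σ≡0⇒≡0 : ∀ {k} {f : Fin k → Carrier} → (∀ i → 0# ≤ f i) → Σ[ f ] ≡ 0# → ∀ i → f i ≡ 0#
  nonneg-Σ≡0⇒≡0 {f = f} 0≤f Σf≡0 i = antisym (subst (f i ≤_) Σf≡0 (nonneg⇒≤Σ 0≤f i)) (0≤f i)

  δ : ∀ {k} → Fin k → Fin k → Carrier
  δ zero    zero    = 1#
  δ zero    (suc _) = 0#
  δ (suc _) zero    = 0#
  δ (suc p) (suc i) = δ p i

  δ-≢ : ∀ {k} {p i : Fin k} → p ≢ i → δ p i ≡ 0#
  δ-≢ {p = zero}  {zero}  p≢i = ⊥-elim (p≢i refl)
  δ-≢ {p = zero}  {suc i} p≢i = refl
  δ-≢ {p = suc p} {zero}  p≢i = refl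
  δ-≢ {p = suc p} {suc i} p≢i = δ-≢ (p≢i ∘ cong suc)

  Σ-δ : ∀ {k} (p : Fin k) (f : Fin k → Carrier) → Σ[ (λ i → δ p i * f i) ] ≡ f p
  Σ-δ zero    f = trans (cong₂ _+_ (*-identityˡ (f zero)) (Σ-zero (λ i → zeroˡ (f (suc i)))))
                        (+-identityʳ (f zero))
  Σ-δ (suc p) f = trans (cong₂ _+_ (zeroˡ (f zero)) (Σ-δ p (f ∘ suc))) (+-identityˡ (f (suc p)))

  χ : ∀ {m} → Subset m → Fin m → Carrier
  χ (_       ∷ T) (suc p) = χ T p
  χ (inside  ∷ T) zero    = 1#
  χ (outside ∷ T) zero    = 0#

  χ-∈ : ∀ {m} {T : Subset m} {p} → p ∈ T → χ T p ≡ 1#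
  χ-∈ here          = refl
  χ-∈ (there p∈T)   = χ-∈ p∈T

  χ-∉ : ∀ {m} {T : Subset m} {p} → p ∉ T → χ T p ≡ 0#
  χ-∉ {T = inside  ∷ T} {zero}  p∉T = ⊥-elim (p∉T here)
  χ-∉ {T = outside ∷ T} {zero}  p∉T = refl
  χ-∉ {T = _       ∷ T} {suc p} p∉T = χ-∉ (p∉T ∘ there)

  ·-comm : ∀ {n} (x y : Point n) → x · y ≡ y · x
  ·-comm x y = Σ-cong (λ j → *-comm (x j) (y j))

  ·-originʳ : ∀ {n} (x : Point n) → x · origin ≡ 0#
  ·-originʳ x = Σ-zero (λ j → zeroʳ (x j))

  ·-linearˡ : ∀ {n} s (u v x : Point n) → (λ k → s * u k + v k) · x ≡ s * (u · x) + v · x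
  ·-linearˡ s u v x = begin
    Σ[ (λ j → (s * u j + v j) * x j) ]            ≡⟨ Σ-cong (λ j → distribʳ (x j) (s * u j) (v j)) ⟩
    Σ[ (λ j → s * u j * x j + v j * x j) ]        ≡⟨ Σ-distrib-+ (λ j → s * u j * x j) (λ j → v j * x j) ⟩
    Σ[ (λ j → s * u j * x j) ] + v · x            ≡⟨ cong (_+ v · x) (Σ-cong (λ j → *-assoc s (u j) (x j))) ⟩
    Σ[ (λ j → s * (u j * x j)) ] + v · x          ≡⟨ cong (_+ v · x) (*-distribˡ-Σ s (λ j → u j * x j)) ⟨
    s * (u · x) + v · x                           ∎
    where open ≡-Reasoning

  -- Equality in 𝔽 is undecidable: a vanishing square only refutes x j ≢ 0#.
  x·x≡0⇒¬¬x≗origin : ∀ {n} {x : Point n} → x · x ≡ 0# → ¬ ¬ (x ≗ origin)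
  x·x≡0⇒¬¬x≗origin {x = x} x·x≡0 = sequence ¬¬-applicative
    (λ j → x*x≡0⇒¬x≢0 (nonneg-Σ≡0⇒≡0 (λ i → 0≤x*x (x i)) x·x≡0 j))
    where open RawMonad ¬¬-Monad renaming (rawApplicative to ¬¬-applicative)

  lincomb : ∀ {k n} → (Fin k → Carrier) → (Fin k → Point n) → Point n
  lincomb w W j = Σ[ (λ i → w i * W i j) ]

  lincomb-· : ∀ {k n} (w : Fin k → Carrier) (W : Fin k → Point n) (x : Point n) →
              lincomb w W · x ≡ Σ[ (λ i → w i * (W i · x)) ]
  lincomb-· w W x = begin
    Σ[ (λ j → Σ[ (λ i → w i * W i j) ] * x j) ]
      ≡⟨ Σ-cong (λ j → *-distribʳ-Σ (x j) (λ i → w i * W i j)) ⟩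
    Σ[ (λ j → Σ[ (λ i → w i * W i j * x j) ]) ]
      ≡⟨ Σ-comm (λ j i → w i * W i j * x j) ⟩
    Σ[ (λ i → Σ[ (λ j → w i * W i j * x j) ]) ]
      ≡⟨ Σ-cong (λ i → Σ-cong (λ j → *-assoc (w i) (W i j) (x j))) ⟩
    Σ[ (λ i → Σ[ (λ j → w i * (W i j * x j)) ]) ]
      ≡⟨ Σ-cong (λ i → *-distribˡ-Σ (w i) (λ j → W i j * x j)) ⟨
    Σ[ (λ i → w i * (W i · x)) ]
      ∎
    where open ≡-Reasoning

  LinearlyIndependent : ∀ {m n} → (Fin m → Point n) → Subset m → Set
  LinearlyIndependent {m} V T =
    (w : Fin m → Carrier) → (∀ i → i ∉ T → w i ≡ 0#) → lincomb w V ≗ origin → ∀ i → w i ≡ 0#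

  EvaluationSurjective : ∀ {m n} → (Fin m → Point n) → Subset m → Set
  EvaluationSurjective {m} V T = (t : Fin m → Carrier) → ∃ λ d → ∀ i → i ∈ T → d · V i ≡ t i

  linInd-tail : ∀ {m n} {V : Fin (suc m) → Point n} {b T} →
                LinearlyIndependent V (b ∷ T) → LinearlyIndependent (V ∘ suc) T
  linInd-tail {V = V} {b} {T} indep w w-support w-combination i =
    indep (0# Vector.∷ w) support combination (suc i)
    where
    support : ∀ i → i ∉ b ∷ T → (0# Vector.∷ w) i ≡ 0#
    support zero    _     = refl
    support (suc i) i∉b∷T = w-support i (i∉b∷T ∘ there)
    combination : lincomb (0# Vector.∷ w) V ≗ origin
    combination j = trans (cong (_+ lincomb w (V ∘ suc) j) (zeroˡ (V zero j)))
                          (trans (+-identityˡ (lincomb w (V ∘ suc) j)) (w-combination j))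

  module ExtendByMember {m n} (V : Fin (suc m) → Point n) (T : Subset m)
                        (indep : LinearlyIndependent V (inside ∷ T))
                        (surj : EvaluationSurjective (V ∘ suc) T) where

    v : Point n
    v = V zero

    W : Fin m → Point n
    W = V ∘ suc

    ε : Fin m → Point n
    ε p = proj₁ (surj (λ i → δ i p))

    ε-dual : ∀ p i → i ∈ T → ε p · W i ≡ δ i p
    ε-dual p = proj₂ (surj (λ i → δ i p))

    -- y is v minus its W-part read off through the dual basis ε, and e corrects y so that it
    -- annihilates W; then e · v = y · y, which is nonzero because y ≠ 0 by independence.
    a b : Fin m → Carrier
    α β : Fin (suc m) → Carrier
    y e : Point n
    a p = χ T p * (ε p · v)
    α   = 1# Vector.∷ (-_ ∘ a)
    y   = lincomb α V
    b p = χ T p * (y · W p)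
    β   = 1# Vector.∷ (-_ ∘ b)
    e   = lincomb β (y Vector.∷ ε)

    e·W≡0 : ∀ i → i ∈ T → e · W i ≡ 0#
    e·W≡0 i i∈T = begin
      e · W i                                          ≡⟨ lincomb-· β (y Vector.∷ ε) (W i) ⟩
      1# * (y · W i) + Σ[ (λ p → - b p * (ε p · W i)) ] ≡⟨ cong₂ _+_ (*-identityˡ (y · W i)) (Σ-cong pick) ⟩
      y · W i + Σ[ (λ p → δ i p * - b p) ]             ≡⟨ cong (y · W i +_) (Σ-δ i (-_ ∘ b)) ⟩
      y · W i + - b i                                  ≡⟨ cong (λ c → y · W i + - (c * (y · W i))) (χ-∈ i∈T) ⟩
      y · W i + - (1# * (y · W i))                     ≡⟨ cong (λ c → y · W i + - c) (*-identityˡ (y · W i)) ⟩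
      y · W i + - (y · W i)                            ≡⟨ -‿inverseʳ (y · W i) ⟩
      0#                                               ∎
      where
      open ≡-Reasoning
      pick : ∀ p → - b p * (ε p · W i) ≡ δ i p * - b p
      pick p = trans (cong (- b p *_) (ε-dual p i i∈T)) (*-comm (- b p) (δ i p))

    e·v≡y·y : e · v ≡ y · y
    e·v≡y·y = begin
      e · v                                            ≡⟨ lincomb-· β (y Vector.∷ ε) v ⟩
      1# * (y · v) + Σ[ (λ p → - b p * (ε p · v)) ]    ≡⟨ cong₂ (λ z s → 1# * z + s) (·-comm y v) (Σ-cong swap) ⟩
      1# * (v · y) + Σ[ (λ p → - a p * (W p · y)) ]    ≡⟨ lincomb-· α V y ⟨
      y · y                                            ∎
      where
      open ≡-Reasoning
      swap : ∀ p → - b p * (ε p · v) ≡ - a p * (W p · y)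
      swap p = begin
        - (χ T p * (y · W p)) * (ε p · v)       ≡⟨ -‿distribˡ-* _ (ε p · v) ⟨
        - (χ T p * (y · W p) * (ε p · v))       ≡⟨ cong -_ (xy∙z≈xz∙y (χ T p) (y · W p) (ε p · v)) ⟩
        - (χ T p * (ε p · v) * (y · W p))       ≡⟨ -‿distribˡ-* _ (y · W p) ⟩
        - (χ T p * (ε p · v)) * (y · W p)       ≡⟨ cong (- a p *_) (·-comm y (W p)) ⟩
        - a p * (W p · y)                       ∎

    y·y≢0 : y · y ≢ 0#
    y·y≢0 y·y≡0 = x·x≡0⇒¬¬x≗origin y·y≡0 (λ y≗0 → 0≢1 (sym (indep α support y≗0 zero)))
      where
      support : ∀ i → i ∉ inside ∷ T → α i ≡ 0#
      support zero    0∉      = ⊥-elim (0∉ here)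
      support (suc p) sp∉     = trans (cong (λ c → - (c * (ε p · v))) (χ-∉ (sp∉ ∘ there)))
                                      (trans (cong -_ (zeroˡ (ε p · v))) -0#≈0#)

    evaluationSurjective : EvaluationSurjective V (inside ∷ T)
    evaluationSurjective t = d , d-values
      where
      e·v≢0 : e · v ≢ 0#
      e·v≢0 = y·y≢0 ∘ trans (sym e·v≡y·y)
      d′ : Point n
      d′ = proj₁ (surj (t ∘ suc))
      d′-values : ∀ i → i ∈ T → d′ · W i ≡ t (suc i)
      d′-values = proj₂ (surj (t ∘ suc))
      s : Carrier
      s = (t zero + - (d′ · v)) * inv (e · v) e·v≢0
      d : Point n
      d k = s * e k + d′ k
      d-values : ∀ i → i ∈ inside ∷ T → d · V i ≡ t i
      d-values zero _ = begin
        d · v                           ≡⟨ ·-linearˡ s e d′ v ⟩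
        s * (e · v) + d′ · v            ≡⟨ cong (_+ d′ · v) (x*y⁻¹*y≡x (t zero + - (d′ · v)) e·v≢0) ⟩
        t zero + - (d′ · v) + d′ · v    ≡⟨ //-rightDividesˡ (d′ · v) (t zero) ⟩
        t zero                          ∎
        where open ≡-Reasoning
      d-values (suc i) (there i∈T) = begin
        d · W i                         ≡⟨ ·-linearˡ s e d′ (W i) ⟩
        s * (e · W i) + d′ · W i        ≡⟨ cong₂ (λ z w → s * z + w) (e·W≡0 i i∈T) (d′-values i i∈T) ⟩
        s * 0# + t (suc i)              ≡⟨ cong (_+ t (suc i)) (zeroʳ s) ⟩
        0# + t (suc i)                  ≡⟨ +-identityˡ (t (suc i)) ⟩
        t (suc i)                       ∎
        where open ≡-Reasoning

  linInd⇒evaluationSurjective : ∀ {m n} {V : Fin m → Point n} {T} →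
                                LinearlyIndependent V T → EvaluationSurjective V T
  linInd⇒evaluationSurjective {T = []} _ t = origin , λ _ ()
  linInd⇒evaluationSurjective {V = V} {outside ∷ T} indep t
    with d , d-values ← linInd⇒evaluationSurjective (linInd-tail {V = V} indep) (t ∘ suc)
    = d , λ { (suc i) (there i∈T) → d-values i i∈T }
  linInd⇒evaluationSurjective {V = V} {inside ∷ T} indep =
    ExtendByMember.evaluationSurjective V T indep (linInd⇒evaluationSurjective (linInd-tail {V = V} indep))

module Faces (𝔽 : OrderedField) where
  open OrderedFieldProperties 𝔽
  open Polytopes 𝔽
  open LinearAlgebra 𝔽

  face-of-face : ∀ {n m} {V : Fin m → Point n} {S T} → IsFace V S → T ⊆ S → (d : Point n) →
                 (∀ i → i ∈ S → d · V i ≤ 1#) → (∀ i → i ∈ S → (d · V i ≡ 1# ⇔ i ∈ T)) → IsFace V T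
  face-of-face {n} {m} {V} {S} {T} (c , b , c·V≤b , c·V≡b⇔) T⊆S d d·V≤1 d·V≡1⇔ =
    c′ , b′ , (λ i → bounded i (i ∈? S)) , λ i → mk⇔ (tight⇒∈T i (i ∈? S)) (∈T⇒tight i)
    where
    slack : Fin m → Carrier
    slack i = b + - (c · V i)

    0≤slack : ∀ i → 0# ≤ slack i
    0≤slack i = x≤y⇒0≤y-x (c·V≤b i)

    slack≢0 : ∀ {i} → i ∉ S → slack i ≢ 0#
    slack≢0 {i} i∉S slack≡0 = i∉S (Equivalence.to (c·V≡b⇔ i) (sym (x∙y⁻¹≈ε⇒x≈y b (c · V i) slack≡0)))

    A : Fin m → Carrier
    A i = proj₁ (nonneg-upperBound (d · V i))

    0≤A : ∀ i → 0# ≤ A i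
    0≤A i = proj₁ (proj₂ (nonneg-upperBound (d · V i)))

    d·V≤A : ∀ i → d · V i ≤ A i
    d·V≤A i = proj₂ (proj₂ (nonneg-upperBound (d · V i)))

    weight : ∀ i → Dec (i ∈ S) → Carrier
    weight i (yes _)   = 0#
    weight i (no  i∉S) = A i * inv (slack i) (slack≢0 i∉S)

    0≤weight : ∀ i dec → 0# ≤ weight i dec
    0≤weight i (yes _)   = ≤-refl
    0≤weight i (no  i∉S) = *-nonneg (0≤A i) (0≤inv (slack≢0 i∉S) (0≤slack i))

    weight-compensates : ∀ {i} → i ∉ S → ∀ dec → d · V i ≤ weight i dec * slack i
    weight-compensates i∉S (yes i∈S) = ⊥-elim (i∉S i∈S)
    weight-compensates {i} _ (no i∉S) = subst (d · V i ≤_) (sym (x*y⁻¹*y≡x (A i) (slack≢0 i∉S))) (d·V≤A i)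

    -- Λ · slack i ≥ d · V i off S, which pushes those vertices below Λ * b, strictly under b′.
    Λ : Carrier
    Λ = Σ[ (λ i → weight i (i ∈? S)) ]

    c′ : Point n
    c′ k = Λ * c k + d k

    b′ : Carrier
    b′ = Λ * b + 1#

    c′·V≡ : ∀ i → c′ · V i ≡ Λ * (c · V i) + d · V i
    c′·V≡ i = ·-linearˡ Λ c d (V i)

    on-S : ∀ {i} → i ∈ S → c′ · V i ≡ Λ * b + d · V i
    on-S {i} i∈S = trans (c′·V≡ i) (cong (λ z → Λ * z + d · V i) (Equivalence.from (c·V≡b⇔ i) i∈S))

    off-S : ∀ {i} → i ∉ S → c′ · V i ≤ Λ * b
    off-S {i} i∉S = begin
      c′ · V i                       ≡⟨ c′·V≡ i ⟩
      Λ * (c · V i) + d · V i        ≤⟨ +-monoˡ-≤ (Λ * (c · V i)) (≤-trans (weight-compensates i∉S (i ∈? S))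
                                          (*-mono-slack (nonneg⇒≤Σ (λ j → 0≤weight j (j ∈? S)) i))) ⟩
      Λ * (c · V i) + Λ * slack i    ≡⟨ distribˡ Λ (c · V i) (slack i) ⟨
      Λ * (c · V i + slack i)        ≡⟨ cong (Λ *_) (trans (+-comm (c · V i) (slack i))
                                                            (//-rightDividesˡ (c · V i) b)) ⟩
      Λ * b                          ∎
      where
      open ≤-Reasoning
      *-mono-slack : ∀ {x y} → x ≤ y → x * slack i ≤ y * slack i
      *-mono-slack {x} {y} x≤y =
        subst₂ _≤_ (*-comm (slack i) x) (*-comm (slack i) y) (*-monoˡ-≤-nonneg (0≤slack i) x≤y)

    bounded : ∀ i → Dec (i ∈ S) → c′ · V i ≤ b′
    bounded i (yes i∈S) = subst (_≤ b′) (sym (on-S i∈S)) (+-monoˡ-≤ (Λ * b) (d·V≤1 i i∈S))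
    bounded i (no  i∉S) = ≤-trans (off-S i∉S) (x≤x+y (Λ * b) 0≤1)

    tight⇒∈T : ∀ i → Dec (i ∈ S) → c′ · V i ≡ b′ → i ∈ T
    tight⇒∈T i (yes i∈S) tight =
      Equivalence.to (d·V≡1⇔ i i∈S) (+-cancelˡ (Λ * b) (d · V i) 1# (trans (sym (on-S i∈S)) tight))
    tight⇒∈T i (no  i∉S) tight = ⊥-elim (x≤y⇒x≢y+1 (off-S i∉S) tight)

    ∈T⇒tight : ∀ i → i ∈ T → c′ · V i ≡ b′
    ∈T⇒tight i i∈T =
      trans (on-S (T⊆S i∈T)) (cong (Λ * b +_) (Equivalence.from (d·V≡1⇔ i (T⊆S i∈T)) i∈T))

  affInd-⊆ : ∀ {n m} {V : Fin m → Point n} {S T} → T ⊆ S → AffinelyIndependent V S → AffinelyIndependent V T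
  affInd-⊆ T⊆S indep w w-support = indep w (λ i i∉S → w-support i (i∉S ∘ T⊆S))

  -- Moving weight − Σ w onto the origin leaves the combination unchanged and makes the weights sum to 0.
  affInd⇒linInd-removeOrigin : ∀ {n m} {V : Fin m → Point n} {S i₀} → AffinelyIndependent V S →
                               i₀ ∈ S → V i₀ ≡ origin → LinearlyIndependent V (S - i₀)
  affInd⇒linInd-removeOrigin {m = m} {V} {S} {i₀} indep i₀∈S V₀≡0 w w-support w-combination i
    with i ≟ i₀
  ... | yes refl  = w-support i₀ (x∉p-x i₀ S)
  ... | no  i≢i₀  = begin
    w i                  ≡⟨ +-identityʳ (w i) ⟨
    w i + 0#             ≡⟨ cong (w i +_) (zeroˡ c) ⟨
    w i + 0# * c         ≡⟨ cong (λ z → w i + z * c) (δ-≢ (i≢i₀ ∘ sym)) ⟨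
    w′ i                 ≡⟨ indep w′ w′-support Σw′≡0 w′-combination i ⟩
    0#                   ∎
    where
    open ≡-Reasoning
    c : Carrier
    c = - Σ[ w ]

    w′ : Fin m → Carrier
    w′ i = w i + δ i₀ i * c

    w′-support : ∀ i → i ∉ S → w′ i ≡ 0#
    w′-support i i∉S = begin
      w i + δ i₀ i * c     ≡⟨ cong₂ (λ x y → x + y * c) (w-support i (i∉S ∘ p─q⊆p S ⁅ i₀ ⁆))
                                                       (δ-≢ (λ i₀≡i → i∉S (subst (_∈ S) i₀≡i i₀∈S))) ⟩
      0# + 0# * c          ≡⟨ +-identityˡ (0# * c) ⟩
      0# * c               ≡⟨ zeroˡ c ⟩
      0#                   ∎

    Σw′≡0 : Σ[ w′ ] ≡ 0#
    Σw′≡0 = begin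
      Σ[ w′ ]                              ≡⟨ Σ-distrib-+ w (λ i → δ i₀ i * c) ⟩
      Σ[ w ] + Σ[ (λ i → δ i₀ i * c) ]     ≡⟨ cong (Σ[ w ] +_) (Σ-δ i₀ (λ _ → c)) ⟩
      Σ[ w ] + - Σ[ w ]                    ≡⟨ -‿inverseʳ Σ[ w ] ⟩
      0#                                   ∎

    w′-combination : lincomb w′ V ≗ origin
    w′-combination j = begin
      Σ[ (λ i → (w i + δ i₀ i * c) * V i j) ]
        ≡⟨ Σ-cong expand ⟩
      Σ[ (λ i → w i * V i j + δ i₀ i * (c * V i j)) ]
        ≡⟨ Σ-distrib-+ (λ i → w i * V i j) (λ i → δ i₀ i * (c * V i j)) ⟩
      lincomb w V j + Σ[ (λ i → δ i₀ i * (c * V i j)) ]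
        ≡⟨ cong₂ _+_ (w-combination j) (Σ-δ i₀ (λ i → c * V i j)) ⟩
      0# + c * V i₀ j
        ≡⟨ cong (λ x → 0# + c * x j) V₀≡0 ⟩
      0# + c * 0#
        ≡⟨ trans (+-identityˡ (c * 0#)) (zeroʳ c) ⟩
      0#
        ∎
      where
      expand : ∀ i → (w i + δ i₀ i * c) * V i j ≡ w i * V i j + δ i₀ i * (c * V i j)
      expand i = trans (distribʳ (V i j) (w i) (δ i₀ i * c)) (cong (w i * V i j +_) (*-assoc (δ i₀ i) c (V i j)))

  simplexFace-removeOrigin : ∀ {n m} {V : Fin m → Point n} {S i₀} → IsSimplexFace V S →
                             i₀ ∈ S → V i₀ ≡ origin → IsSimplexFace V (S - i₀)
  simplexFace-removeOrigin {n} {V = V} {S} {i₀} (face , indep) i₀∈S V₀≡0 =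
    face-of-face face S-i₀⊆S d d·V≤1 d·V≡1⇔ , affInd-⊆ S-i₀⊆S indep
    where
    S-i₀⊆S : S - i₀ ⊆ S
    S-i₀⊆S = p─q⊆p S ⁅ i₀ ⁆

    exposing : ∃ λ d → ∀ i → i ∈ S - i₀ → d · V i ≡ 1#
    exposing = linInd⇒evaluationSurjective (affInd⇒linInd-removeOrigin indep i₀∈S V₀≡0) (λ _ → 1#)

    d : Point n
    d = proj₁ exposing

    d·V≡1 : ∀ i → i ∈ S - i₀ → d · V i ≡ 1#
    d·V≡1 = proj₂ exposing

    d·V₀≡0 : d · V i₀ ≡ 0#
    d·V₀≡0 = trans (cong (d ·_) V₀≡0) (·-originʳ d)

    d·V≤1 : ∀ i → i ∈ S → d · V i ≤ 1#
    d·V≤1 i i∈S with x∈p⇒x≡y⊎x∈p-y {y = i₀} i∈S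
    ... | inj₁ refl      = subst (_≤ 1#) (sym d·V₀≡0) 0≤1
    ... | inj₂ i∈S-i₀    = ≤-reflexive (d·V≡1 i i∈S-i₀)

    d·V≡1⇔ : ∀ i → i ∈ S → (d · V i ≡ 1# ⇔ i ∈ S - i₀)
    d·V≡1⇔ i i∈S = mk⇔ to (d·V≡1 i)
      where
      to : d · V i ≡ 1# → i ∈ S - i₀
      to d·V≡1 with x∈p⇒x≡y⊎x∈p-y {y = i₀} i∈S
      ... | inj₁ refl      = ⊥-elim (0≢1 (trans (sym d·V₀≡0) d·V≡1))
      ... | inj₂ i∈S-i₀    = i∈S-i₀

corollary3p7 : (𝔽 : OrderedField) → let open Polytopes 𝔽 in
    (n m : ℕ) (V : Fin m → Point n) →
    IsVertexList V →
    (∃ λ i → V i ≡ origin) →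
    (k : ℕ) → CardLe (S⁰-term V k) (xS¹-term V k)
corollary3p7 𝔽 n m V (V-injective , _) (i₀ , V₀≡0) k =
  cardLe-injection (_- i₀) removeOrigin
    (λ (_ , 0∈S , _) (_ , 0∈S′ , _) → p-x≡q-x⇒p≡q (i₀∈ 0∈S) (i₀∈ 0∈S′))
  where
  open Polytopes 𝔽
  open Faces 𝔽

  i₀∈ : ∀ {S} → ContainsOrigin V S → i₀ ∈ S
  i₀∈ {S} (i , i∈S , Vi≡0) = subst (_∈ S) (V-injective i i₀ (trans Vi≡0 (sym V₀≡0))) i∈S

  removeOrigin : ∀ {S} → S⁰-term V k S → xS¹-term V k (S - i₀)
  removeOrigin {S} (simplex , 0∈S , ∣S∣≡k) =
    simplexFace-removeOrigin simplex (i₀∈ 0∈S) V₀≡0 ,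
    (λ 0∈S-i₀ → x∉p-x i₀ S (i₀∈ 0∈S-i₀)) ,
    trans (x∈p⇒∣p-x∣+1≡∣p∣ (i₀∈ 0∈S)) ∣S∣≡k
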